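{- Let $k,l\in\mathbb{N}$ with $k\in\mathcal{N}$. Let $\vec\Gamma$ be a context stack and $\Gamma_0,\Delta_0,\Delta_1,\dots,\Delta_l$ contexts, and suppose $\vec\Gamma;\Gamma_0;\Delta_0;\Delta_1;\dots;\Delta_l\vdash t:T$. Then for all contexts $\Gamma_1,\dots,\Gamma_k$ (with the variables of $\Gamma_k$ and $\Delta_0$ distinct), $$\vec\Gamma;\Gamma_0;\Gamma_1;\dots;\Gamma_{k-1};(\Gamma_k,\Delta_0);\Delta_1;\dots;\Delta_l\vdash t\{k/l\}:T,$$ where for $k=0$ the stack on the left is to be read as $\vec\Gamma;(\Gamma_0,\Delta_0);\Delta_1;\dots;\Delta_l$.
   Context: Fix a set $\mathcal{N}\subseteq\mathbb{N}$ of permitted unbox levels, which is one of $\{1\}$ (system K), $\{0,1\}$ (system T), $\mathbb{N}$ (system S4) or $\{n\mid n\ge1\}$ (system K4). Types: $T::=B\mid\square T\mid S\longrightarrow T$ ($B$ a base type). Terms: $t::=x\mid\mathsf{box}\,t\mid\mathsf{unbox}_n\,t\mid\lambda x.t\mid s\ t$ with $n\in\mathbb{N}$; variables are names and terms are taken up to $\alpha$-renaming. Contexts $\Gamma::=\cdot\mid\Gamma,x:T$; context stacks $\vec\Gamma::=\epsilon\mid\vec\Gamma;\Gamma$ (finite sequences of contexts, the last one written being the topmost); $|\vec\Gamma|$ is the number of contexts and $\vec\Gamma;\vec\Delta$ denotes concatenation with $\vec\Delta$ on top; $(\Gamma,\Gamma')$ is concatenation of contexts. The typing judgment $\vec\Gamma\vdash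 t:T$ (only for stacks of length at least $1$) is inductively defined by: if $x:T\in\Gamma$ then $\vec\Gamma;\Gamma\vdash x:T$; if $\vec\Gamma;\cdot\vdash t:T$ then $\vec\Gamma\vdash\mathsf{box}\,t:\square T$; if $\vec\Gamma\vdash t:\square T$, $|\vec\Delta|=n$ and $n\in\mathcal{N}$ then $\vec\Gamma;\vec\Delta\vdash\mathsf{unbox}_n\,t:T$; if $\vec\Gamma;(\Gamma,x:S)\vdash t:T$ then $\vec\Gamma;\Gamma\vdash\lambda x.t:S\longrightarrow T$; if $\vec\Gamma\vdash t:S\longrightarrow T$ and $\vec\Gamma\vdash s:S$ then $\vec\Gamma\vdash t\ s:T$. The modal transformation $t\{k/l\}$ ($k,l\in\mathbb{N}$) is defined by: $x\{k/l\}=x$; $(\mathsf{box}\,t)\{k/l\}=\mathsf{box}(t\{k/l+1\})$; $(\mathsf{unbox}_n\,t)\{k/l\}=\mathsf{unbox}_n(t\{k/l-n\})$ if $n\le l$ and $=\mathsf{unbox}_{k+n-1}\,t$ if $n>l$; $(\lambda x.t)\{k/l\}=\lambda x.(t\{k/l\})$; $(s\ t)\{k/l\}=(s\{k/l\})\ (t\{k/l\})$. -}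

module Defs where

open import Data.Nat using (ℕ; zero; suc; _+_; _∸_; _≤_; _≤?_)
open import Data.Vec using (Vec; []; _∷_)
open import Relation.Nullary using (¬_; yes; no)
open import Relation.Binary.PropositionalEquality using (_≡_)

data System : Set where
  sysK sysT sysS4 sysK4 : System

data 𝒩 : System → ℕ → Set where
  K-1   : 𝒩 sysK 1
  T-0   : 𝒩 sysT 0
  T-1   : 𝒩 sysT 1
  S4-n  : ∀ n → 𝒩 sysS4 n
  K4-n  : ∀ n → 𝒩 sysK4 (suc n)

Name : Set
Name = ℕ

data Ty : Set where
  base : ℕ → Ty
  □_   : Ty → Ty
  _⟶_  : Ty → Ty → Ty

data Tm : Set where
  var   : Name → Tm
  box   : Tm → Tm
  unbox : ℕ → Tm → Tm
  lam   : Name → Tm → Tm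
  app   : Tm → Tm → Tm

infixl 5 _,_∶_
data Ctx : Set where
  ·     : Ctx
  _,_∶_ : Ctx → Name → Ty → Ctx

data _∶_∈_ : Name → Ty → Ctx → Set where
  here  : ∀ {Γ x T} → x ∶ T ∈ (Γ , x ∶ T)
  there : ∀ {Γ x T y S} → x ∶ T ∈ Γ → x ∶ T ∈ (Γ , y ∶ S)

data _∈dom_ : Name → Ctx → Set where
  here  : ∀ {Γ x T} → x ∈dom (Γ , x ∶ T)
  there : ∀ {Γ x y S} → x ∈dom Γ → x ∈dom (Γ , y ∶ S)

_++c_ : Ctx → Ctx → Ctx
Γ ++c ·            = Γ
Γ ++c (Γ' , x ∶ T) = (Γ ++c Γ') , x ∶ T

-- Context stacks (last written = topmost)
infixl 4 _⨾_
data Stk : Set where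
  ε   : Stk
  _⨾_ : Stk → Ctx → Stk

_++s_ : Stk → Stk → Stk
Γs ++s ε        = Γs
Γs ++s (Δs ⨾ Δ) = (Γs ++s Δs) ⨾ Δ

len : Stk → ℕ
len ε        = 0
len (Γs ⨾ _) = suc (len Γs)

data _⊢_⦂_ (𝓈 : System) : Stk → Tm → Ty → Set where
  ⊢var   : ∀ {Γs Γ x T} → x ∶ T ∈ Γ → _⊢_⦂_ 𝓈 (Γs ⨾ Γ) (var x) T
  ⊢box   : ∀ {Γs t T} → _⊢_⦂_ 𝓈 (Γs ⨾ ·) t T → _⊢_⦂_ 𝓈 Γs (box t) (□ T)
  ⊢unbox : ∀ {Γs Δs t T n} → _⊢_⦂_ 𝓈 Γs t (□ T) → len Δs ≡ n → 𝒩 𝓈 n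
         → _⊢_⦂_ 𝓈 (Γs ++s Δs) (unbox n t) T
  ⊢lam   : ∀ {Γs Γ x S t T} → _⊢_⦂_ 𝓈 (Γs ⨾ (Γ , x ∶ S)) t T
         → _⊢_⦂_ 𝓈 (Γs ⨾ Γ) (lam x t) (S ⟶ T)
  ⊢app   : ∀ {Γs t s S T} → _⊢_⦂_ 𝓈 Γs t (S ⟶ T) → _⊢_⦂_ 𝓈 Γs s S
         → _⊢_⦂_ 𝓈 Γs (app t s) T

_∣_⊢_∶_ : System → Stk → Tm → Ty → Set
𝓈 ∣ Γs ⊢ t ∶ T = _⊢_⦂_ 𝓈 Γs t T

_[_/_] : Tm → ℕ → ℕ → Tm
var x       [ k / l ] = var x
box t       [ k / l ] = box (t [ k / suc l ])
unbox n t   [ k / l ] with n ≤? l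
... | yes _ = unbox n (t [ k / l ∸ n ])
... | no  _ = unbox (k + n ∸ 1) t
lam x t     [ k / l ] = lam x (t [ k / l ])
app s t     [ k / l ] = app (s [ k / l ]) (t [ k / l ])

-- push a vector of contexts on a stack, first element lowest: Γ⃗;Δ₁;…;Δₗ
pushAll : ∀ {l} → Stk → Vec Ctx l → Stk
pushAll Γs []       = Γs
pushAll Γs (Δ ∷ Δs) = pushAll (Γs ⨾ Δ) Δs

-- Γ⃗;Γ₀;Γ₁;…;Γ_{k-1};(Γ_k,Δ₀)   (for k = 0: Γ⃗;(Γ₀,Δ₀))
-- arguments: Γ⃗, Γ₀, [Γ₁,…,Γ_k], Δ₀
mergeTop : ∀ {k} → Stk → Ctx → Vec Ctx k → Ctx → Stk
mergeTop Γs Γ₀ []         Δ₀ = Γs ⨾ (Γ₀ ++c Δ₀)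
mergeTop Γs Γ₀ (Γ₁ ∷ Γs') Δ₀ = mergeTop (Γs ⨾ Γ₀) Γ₁ Γs' Δ₀

lastCtx : ∀ {k} → Ctx → Vec Ctx k → Ctx
lastCtx Γ₀ []         = Γ₀
lastCtx Γ₀ (Γ₁ ∷ Γs') = lastCtx Γ₁ Γs'

Disjoint : Ctx → Ctx → Set
Disjoint Γ Δ = ∀ x → x ∈dom Γ → ¬ (x ∈dom Δ)

-- Induction on the typing derivation, generalised over the contexts Δ₁;…;Δₗ above Δ₀: box
-- pushes one more of them, λ extends the topmost. The interesting rule is unbox n. If n ≤ l it
-- only pops contexts above Δ₀ and stays unbox n. If n > l it pops Δ₀ and reaches into Γ⃗;Γ₀;
-- the new stack inserts Γ₁;…;Γₖ between Γ₀ and Δ₀ and merges Γₖ with Δ₀, so the same target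
-- lies k - 1 contexts further down and the level becomes k + n - 1, which 𝒩 permits whenever
-- k and n are permitted. For k = 0 the stack shrinks instead (Γ₀ and Δ₀ merge), and an unbox reaching
-- exactly Γ₀ now sees the larger context Γ₀,Δ₀, so weakening is needed.
module Submission where

open import Defs
open import Data.Nat using (ℕ; suc; _+_; _∸_; _≤_; _<_; _≤?_; s≤s)
open import Data.Nat.Properties using (+-identityʳ; +-suc; +-assoc; m+n∸n≡m; ≰⇒>)
open import Data.Product using (_×_; _,_; ∃; ∃₂)
open import Data.Vec using (Vec; []; _∷_)
open import Relation.Nullary using (yes; no)
open import Relation.Binary.PropositionalEquality

++s-assoc : ∀ A B C → (A ++s B) ++s C ≡ A ++s (B ++s C)
++s-assoc A B ε       = refl
++s-assoc A B (C ⨾ Γ) = cong (_⨾ Γ) (++s-assoc A B C)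

len-++s : ∀ A B → len (A ++s B) ≡ len A + len B
len-++s A ε       = sym (+-identityʳ (len A))
len-++s A (B ⨾ Γ) = trans (cong suc (len-++s A B)) (sym (+-suc (len A) (len B)))

len-++s-∸ : ∀ A B → len (A ++s B) ∸ len B ≡ len A
len-++s-∸ A B = trans (cong (_∸ len B) (len-++s A B)) (m+n∸n≡m (len A) (len B))

⨾-injective : ∀ {A B Γ Δ} → (A ⨾ Γ) ≡ (B ⨾ Δ) → A ≡ B × Γ ≡ Δ
⨾-injective refl = refl , refl

++s-split-≤ : ∀ A Es C Ds → A ++s Es ≡ C ++s Ds → len Es ≤ len Ds →
  ∃ λ X → A ≡ C ++s X × Ds ≡ X ++s Es
++s-split-≤ A ε        C Ds       eq _ = Ds , eq , refl
++s-split-≤ A (Es ⨾ Γ) C (Ds ⨾ Δ) eq (s≤s le) with ⨾-injective eq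
... | eq′ , refl with ++s-split-≤ A Es C Ds eq′ le
...   | X , A≡ , Ds≡ = X , A≡ , cong (_⨾ Γ) Ds≡

++s-split-> : ∀ A Es C Γ Ds → A ++s Es ≡ (C ⨾ Γ) ++s Ds → len Ds < len Es →
  ∃ λ X → C ≡ A ++s X × Es ≡ (X ⨾ Γ) ++s Ds
++s-split-> A (Es ⨾ Γ′) C Γ ε        refl _ = Es , refl , refl
++s-split-> A (Es ⨾ Γ′) C Γ (Ds ⨾ Δ) eq (s≤s lt) with ⨾-injective eq
... | eq′ , refl with ++s-split-> A Es C Γ Ds eq′ lt
...   | X , C≡ , Es≡ = X , C≡ , cong (_⨾ Γ′) Es≡

pushAll-++s : ∀ {l} A B (Δs : Vec Ctx l) → pushAll (A ++s B) Δs ≡ A ++s pushAll B Δs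
pushAll-++s A B []       = refl
pushAll-++s A B (Δ ∷ Δs) = pushAll-++s A (B ⨾ Δ) Δs

len-pushAll : ∀ {l} A (Δs : Vec Ctx l) → len (pushAll A Δs) ≡ len A + l
len-pushAll A []               = sym (+-identityʳ (len A))
len-pushAll {suc l} A (Δ ∷ Δs) = trans (len-pushAll (A ⨾ Δ) Δs) (sym (+-suc (len A) l))

𝒩-+∸1 : ∀ {𝓈 k n} → 𝒩 𝓈 k → 𝒩 𝓈 n → 𝒩 𝓈 (k + n ∸ 1)
𝒩-+∸1 K-1      K-1      = K-1
𝒩-+∸1 T-0      T-0      = T-0
𝒩-+∸1 T-0      T-1      = T-0
𝒩-+∸1 T-1      T-0      = T-0
𝒩-+∸1 T-1      T-1      = T-1
𝒩-+∸1 (S4-n k) (S4-n n) = S4-n _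
𝒩-+∸1 (K4-n k) (K4-n n) = subst (𝒩 sysK4) (sym (+-suc k n)) (K4-n (k + n))

∈-++⁺ˡ : ∀ {x T} Γ Δ → x ∶ T ∈ Γ → x ∶ T ∈ (Γ ++c Δ)
∈-++⁺ˡ Γ ·           x∈ = x∈
∈-++⁺ˡ Γ (Δ , y ∶ S) x∈ = there (∈-++⁺ˡ Γ Δ x∈)

∈-++⁺ʳ : ∀ {x T} Γ Δ → x ∶ T ∈ Δ → x ∶ T ∈ (Γ ++c Δ)
∈-++⁺ʳ Γ (Δ , y ∶ S) here      = here
∈-++⁺ʳ Γ (Δ , y ∶ S) (there x∈) = there (∈-++⁺ʳ Γ Δ x∈)

_⊆_ : Ctx → Ctx → Set
Γ ⊆ Γ′ = ∀ {x T} → x ∶ T ∈ Γ → x ∶ T ∈ Γ′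

data _⊑_ : Stk → Stk → Set where
  ε  : ε ⊑ ε
  _⨾_ : ∀ {Ψ Ψ′ Γ Γ′} → Ψ ⊑ Ψ′ → Γ ⊆ Γ′ → (Ψ ⨾ Γ) ⊑ (Ψ′ ⨾ Γ′)

⊑-refl : ∀ Ψ → Ψ ⊑ Ψ
⊑-refl ε       = ε
⊑-refl (Ψ ⨾ Γ) = ⊑-refl Ψ ⨾ λ x∈ → x∈

⊑-split : ∀ A B {Ψ′} → (A ++s B) ⊑ Ψ′ →
  ∃₂ λ A′ B′ → A ⊑ A′ × len B′ ≡ len B × Ψ′ ≡ A′ ++s B′
⊑-split A ε       A⊑ = _ , ε , A⊑ , refl , refl
⊑-split A (B ⨾ Γ) (AB⊑ ⨾ Γ⊆) with ⊑-split A B AB⊑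
... | A′ , B′ , A⊑A′ , len≡ , refl = A′ , (B′ ⨾ _) , A⊑A′ , cong suc len≡ , refl

weaken : ∀ {𝓈 Ψ Ψ′ t T} → 𝓈 ∣ Ψ ⊢ t ∶ T → Ψ ⊑ Ψ′ → 𝓈 ∣ Ψ′ ⊢ t ∶ T
weaken (⊢var x∈)  (Ψ⊑ ⨾ Γ⊆) = ⊢var (Γ⊆ x∈)
weaken (⊢box ⊢t)  Ψ⊑         = ⊢box (weaken ⊢t (Ψ⊑ ⨾ λ x∈ → x∈))
weaken (⊢lam ⊢t)  (Ψ⊑ ⨾ Γ⊆) = ⊢lam (weaken ⊢t (Ψ⊑ ⨾ λ { here → here ; (there x∈) → there (Γ⊆ x∈) }))
weaken (⊢app ⊢t ⊢s) Ψ⊑       = ⊢app (weaken ⊢t Ψ⊑) (weaken ⊢s Ψ⊑)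
weaken (⊢unbox {Γs = A} {Δs = B} ⊢t len≡ n∈𝒩) AB⊑ with ⊑-split A B AB⊑
... | A′ , B′ , A⊑A′ , len≡′ , refl = ⊢unbox (weaken ⊢t A⊑A′) (trans len≡′ len≡) n∈𝒩

⊢unbox-≡ : ∀ {𝓈 Ψ A Es t T n} → 𝓈 ∣ A ⊢ t ∶ (□ T) → Ψ ≡ A ++s Es → len Es ≡ n → 𝒩 𝓈 n →
  𝓈 ∣ Ψ ⊢ unbox n t ∶ T
⊢unbox-≡ ⊢t refl = ⊢unbox ⊢t

⊢var-mergeTop : ∀ {𝓈 k x T} Γs Γ₀ (Γks : Vec Ctx k) Δ₀ → x ∶ T ∈ Δ₀ →
  𝓈 ∣ mergeTop Γs Γ₀ Γks Δ₀ ⊢ var x ∶ T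
⊢var-mergeTop Γs Γ₀ []         Δ₀ x∈ = ⊢var (∈-++⁺ʳ Γ₀ Δ₀ x∈)
⊢var-mergeTop Γs Γ₀ (Γ₁ ∷ Γks) Δ₀ x∈ = ⊢var-mergeTop (Γs ⨾ Γ₀) Γ₁ Γks Δ₀ x∈

⊢lam-mergeTop : ∀ {𝓈 k x S t T} Γs Γ₀ (Γks : Vec Ctx k) Δ₀ →
  𝓈 ∣ mergeTop Γs Γ₀ Γks (Δ₀ , x ∶ S) ⊢ t ∶ T → 𝓈 ∣ mergeTop Γs Γ₀ Γks Δ₀ ⊢ lam x t ∶ (S ⟶ T)
⊢lam-mergeTop Γs Γ₀ []         Δ₀ ⊢t = ⊢lam ⊢t
⊢lam-mergeTop Γs Γ₀ (Γ₁ ∷ Γks) Δ₀ ⊢t = ⊢lam-mergeTop (Γs ⨾ Γ₀) Γ₁ Γks Δ₀ ⊢t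

mergeTop-⊒ : ∀ {k} Γs Γ₀ (Γks : Vec Ctx k) Δ₀ A X → (Γs ⨾ Γ₀) ≡ A ++s X →
  ∃₂ λ A′ Y → A ⊑ A′ × mergeTop Γs Γ₀ Γks Δ₀ ≡ A′ ++s Y × len Y ≡ k + len X
mergeTop-⊒ Γs Γ₀ [] Δ₀ A ε refl = _ , ε , (⊑-refl Γs ⨾ ∈-++⁺ˡ Γ₀ Δ₀) , refl , refl
mergeTop-⊒ Γs Γ₀ [] Δ₀ A (X ⨾ Γ) eq with ⨾-injective eq
... | Γs≡ , refl = A , (X ⨾ (Γ₀ ++c Δ₀)) , ⊑-refl A , cong (_⨾ (Γ₀ ++c Δ₀)) Γs≡ , refl
mergeTop-⊒ {suc k} Γs Γ₀ (Γ₁ ∷ Γks) Δ₀ A X eq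
  with mergeTop-⊒ (Γs ⨾ Γ₀) Γ₁ Γks Δ₀ A (X ⨾ Γ₁) (cong (_⨾ Γ₁) eq)
... | A′ , Y , A⊑A′ , M≡ , lenY = A′ , Y , A⊑A′ , M≡ , trans lenY (+-suc k (len X))

module _ {𝓈 k} (k∈𝒩 : 𝒩 𝓈 k) (Γs : Stk) (Γ₀ : Ctx) (Γks : Vec Ctx k) where

  ⊢-[/] : ∀ Δ₀ Ds {Ψ t T} → 𝓈 ∣ Ψ ⊢ t ∶ T → Ψ ≡ (Γs ⨾ Γ₀ ⨾ Δ₀) ++s Ds →
    𝓈 ∣ mergeTop Γs Γ₀ Γks Δ₀ ++s Ds ⊢ t [ k / len Ds ] ∶ T
  ⊢-[/] Δ₀ ε        (⊢var x∈)    refl = ⊢var-mergeTop Γs Γ₀ Γks Δ₀ x∈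
  ⊢-[/] Δ₀ (Ds ⨾ Δ) (⊢var x∈)    refl = ⊢var x∈
  ⊢-[/] Δ₀ Ds       (⊢box ⊢t)    refl = ⊢box (⊢-[/] Δ₀ (Ds ⨾ ·) ⊢t refl)
  ⊢-[/] Δ₀ ε        (⊢lam ⊢t)    refl = ⊢lam-mergeTop Γs Γ₀ Γks Δ₀ (⊢-[/] (Δ₀ , _ ∶ _) ε ⊢t refl)
  ⊢-[/] Δ₀ (Ds ⨾ Δ) (⊢lam ⊢t)    refl = ⊢lam (⊢-[/] Δ₀ (Ds ⨾ (Δ , _ ∶ _)) ⊢t refl)
  ⊢-[/] Δ₀ Ds       (⊢app ⊢t ⊢s) refl = ⊢app (⊢-[/] Δ₀ Ds ⊢t refl) (⊢-[/] Δ₀ Ds ⊢s refl)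
  ⊢-[/] Δ₀ Ds (⊢unbox {Γs = A} {Δs = Es} {t = t} {T = T} ⊢t refl n∈𝒩) eq with len Es ≤? len Ds
  ... | yes n≤l with ++s-split-≤ A Es _ Ds eq n≤l
  ...   | X , refl , refl =
    ⊢unbox-≡ (subst (λ m → 𝓈 ∣ M ++s X ⊢ t [ k / m ] ∶ (□ T)) (sym (len-++s-∸ X Es)) (⊢-[/] Δ₀ X ⊢t refl))
             (sym (++s-assoc M X Es)) refl n∈𝒩
    where M = mergeTop Γs Γ₀ Γks Δ₀
  ⊢-[/] Δ₀ Ds (⊢unbox {Γs = A} {Δs = Es} {t = t} {T = T} ⊢t refl n∈𝒩) eq
      | no n≰l with ++s-split-> A Es (Γs ⨾ Γ₀) Δ₀ Ds eq (≰⇒> n≰l)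
  ...   | X , Γs⨾Γ₀≡ , refl with mergeTop-⊒ Γs Γ₀ Γks Δ₀ A X Γs⨾Γ₀≡
  ...     | A′ , Y , A⊑A′ , M≡ , lenY =
    ⊢unbox-≡ (weaken ⊢t A⊑A′) (trans (cong (_++s Ds) M≡) (++s-assoc A′ Y Ds)) len≡ (𝒩-+∸1 k∈𝒩 n∈𝒩)
    where
    open ≡-Reasoning
    len≡ : len (Y ++s Ds) ≡ k + len ((X ⨾ Δ₀) ++s Ds) ∸ 1
    len≡ = begin
      len (Y ++s Ds)                     ≡⟨ len-++s Y Ds ⟩
      len Y + len Ds                     ≡⟨ cong (_+ len Ds) lenY ⟩
      k + len X + len Ds                 ≡⟨ +-assoc k (len X) (len Ds) ⟩
      k + (len X + len Ds)               ≡⟨ cong (_∸ 1) (+-suc k (len X + len Ds)) ⟨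
      k + suc (len X + len Ds) ∸ 1       ≡⟨ cong (λ m → k + m ∸ 1) (len-++s (X ⨾ Δ₀) Ds) ⟨
      k + len ((X ⨾ Δ₀) ++s Ds) ∸ 1      ∎

lemma2p2 : (𝓈 : System) (k l : ℕ) → 𝒩 𝓈 k →
    (Γs : Stk) (Γ₀ Δ₀ : Ctx) (Δs : Vec Ctx l) (t : Tm) (T : Ty) →
    𝓈 ∣ pushAll (Γs ⨾ Γ₀ ⨾ Δ₀) Δs ⊢ t ∶ T →
    (Γks : Vec Ctx k) → Disjoint (lastCtx Γ₀ Γks) Δ₀ →
    𝓈 ∣ pushAll (mergeTop Γs Γ₀ Γks Δ₀) Δs ⊢ t [ k / l ] ∶ T
lemma2p2 𝓈 k l k∈𝒩 Γs Γ₀ Δ₀ Δs t T ⊢t Γks _ =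
  subst₂ (λ Ψ m → 𝓈 ∣ Ψ ⊢ t [ k / m ] ∶ T)
    (sym (pushAll-++s (mergeTop Γs Γ₀ Γks Δ₀) ε Δs)) (len-pushAll ε Δs)
    (⊢-[/] k∈𝒩 Γs Γ₀ Γks Δ₀ (pushAll ε Δs) ⊢t (pushAll-++s (Γs ⨾ Γ₀ ⨾ Δ₀) ε Δs))
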